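{- Let $\Delta$ be a strongly shellable simplicial complex of dimension $d$. Then the pure $d$-th skeleton $\Delta^{[d]}$ is also strongly shellable.
   Context: A simplicial complex is a finite family of subsets of a vertex set closed under taking subsets; $\mathcal{F}(\Delta)$ is its set of facets, $\dim(A)=|A|-1$. A linear order $F_1,\dots,F_t$ of $\mathcal{F}(\Delta)$ is a strong shelling order if for every $1\le i<j\le t$ there exists $k$ with $1\le k<j$ such that $|F_j\setminus F_k|=1$, $F_j\setminus F_k\subseteq F_j\setminus F_i$, and $F_k\setminus F_j\subseteq F_i$; $\Delta$ is strongly shellable if such an order exists. The pure $i$-th skeleton $\Delta^{[i]}$ is the subcomplex of $\Delta$ generated by all $i$-dimensional faces of $\Delta$. -}

module Defs where

open import Data.Nat using (ℕ; suc; _≤_; _<_)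
open import Data.Fin using (Fin; toℕ)
open import Data.Fin.Subset using (Subset; _⊆_; _─_; ∣_∣)
open import Data.List using (List; length; lookup)
open import Data.List.Relation.Unary.Unique.Propositional using (Unique)
import Data.List.Membership.Propositional as M
open import Data.Product using (Σ; ∃; ∃-syntax; _×_)
open import Relation.Binary.PropositionalEquality using (_≡_)
open import Relation.Nullary using (¬_)

-- A family of faces on the vertex set Fin n, given as a predicate on subsets.
-- (Finiteness is automatic since Subset n is finite.)
Family : ℕ → Set₁
Family n = Subset n → Set

IsSimplicialComplex : ∀ {n} → Family n → Set
IsSimplicialComplex {n} Δ = ∀ (A B : Subset n) → Δ A → B ⊆ A → Δ B

-- dim(A) = |A| - 1 ; so "dim A ≡ d" is "∣ A ∣ ≡ suc d".
-- Δ has dimension d: some face of dimension d, every face of dimension ≤ d.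
HasDimension : ∀ {n} → Family n → ℕ → Set
HasDimension {n} Δ d =
  (∃[ A ] (Δ A × ∣ A ∣ ≡ suc d)) × (∀ (A : Subset n) → Δ A → ∣ A ∣ ≤ suc d)

IsFacet : ∀ {n} → Family n → Subset n → Set
IsFacet {n} Δ F = Δ F × (∀ (G : Subset n) → Δ G → F ⊆ G → G ≡ F)

IsFacetOrder : ∀ {n} → Family n → List (Subset n) → Set
IsFacetOrder {n} Δ L =
  Unique L × (∀ (F : Subset n) → (F M.∈ L → IsFacet Δ F) × (IsFacet Δ F → F M.∈ L))

IsStrongShellingOrder : ∀ {n} → Family n → List (Subset n) → Set
IsStrongShellingOrder {n} Δ L =
  IsFacetOrder Δ L ×
  (∀ (i j : Fin (length L)) → toℕ i < toℕ j →
     ∃[ k ] (toℕ k < toℕ j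
            × ∣ lookup L j ─ lookup L k ∣ ≡ 1
            × (lookup L j ─ lookup L k) ⊆ (lookup L j ─ lookup L i)
            × (lookup L k ─ lookup L j) ⊆ lookup L i))

StronglyShellable : ∀ {n} → Family n → Set
StronglyShellable {n} Δ = ∃[ L ] IsStrongShellingOrder Δ L

PureSkeleton : ∀ {n} → Family n → ℕ → Family n
PureSkeleton {n} Δ i G = ∃[ F ] (Δ F × ∣ F ∣ ≡ suc i × G ⊆ F)

-- The d-dimensional faces of Δ are exactly the facets of Δ of size d + 1, and they are also the
-- facets of Δ^[d]. So the candidate order is the strong shelling order of Δ with all smaller
-- facets deleted. It remains a strong shelling order because the witness F_k chosen for a pair
-- F_i, F_j of size d + 1 has size d + 1 itself: since F_j ∖ F_k is a single vertex,
-- |F_j ∩ F_k| = d, so a facet F_k of size ≤ d would lie inside F_j.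
module Submission where

open import Defs
open import Data.Nat using (ℕ; suc; _+_; _≤_; _<_; _≟_; z≤n; s≤s)
open import Data.Nat.Properties using (+-suc; ≤-trans; ≤-pred; <-irrefl; ≮⇒≥; ≤-antisym; ≤-reflexive)
open import Data.Fin using (Fin; toℕ) renaming (zero to fzero; suc to fsuc)
open import Data.Fin.Subset using (Subset; _⊆_; _─_; _∩_; ∣_∣; inside; outside)
open import Data.Fin.Subset.Properties
  using (⊆-antisym; ⊆-trans; drop-∷-⊆; s⊆s; p⊆q⇒∣p∣≤∣q∣; p∩q⊆p; p∩q⊆q)
open import Data.Vec using ([]; _∷_; here)
open import Data.List using (List; _∷_; length; lookup; filter)
open import Data.List.Membership.Propositional using (_∈_)
open import Data.List.Membership.Propositional.Properties using (∈-lookup; ∈-filter⁺; ∈-filter⁻)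
open import Data.List.Relation.Unary.Unique.Propositional.Properties using (filter⁺)
open import Data.Product using (∃-syntax; _×_; _,_; proj₁; proj₂)
open import Function using (id; _⇔_; mk⇔; Equivalence)
open import Relation.Binary.PropositionalEquality using (_≡_; refl; sym; trans; cong; subst; subst₂)
open import Relation.Nullary using (yes; no; contradiction)
open import Relation.Unary using (Pred; Decidable)

private
  variable
    n : ℕ

∣p∣≡∣p─q∣+∣p∩q∣ : (p q : Subset n) → ∣ p ∣ ≡ ∣ p ─ q ∣ + ∣ p ∩ q ∣
∣p∣≡∣p─q∣+∣p∩q∣ []            []            = refl
∣p∣≡∣p─q∣+∣p∩q∣ (inside  ∷ p) (inside  ∷ q) = trans (cong suc (∣p∣≡∣p─q∣+∣p∩q∣ p q)) (sym (+-suc _ _))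
∣p∣≡∣p─q∣+∣p∩q∣ (inside  ∷ p) (outside ∷ q) = cong suc (∣p∣≡∣p─q∣+∣p∩q∣ p q)
∣p∣≡∣p─q∣+∣p∩q∣ (outside ∷ p) (inside  ∷ q) = ∣p∣≡∣p─q∣+∣p∩q∣ p q
∣p∣≡∣p─q∣+∣p∩q∣ (outside ∷ p) (outside ∷ q) = ∣p∣≡∣p─q∣+∣p∩q∣ p q

p⊆q⇒∣q∣≤∣p∣⇒q⊆p : {p q : Subset n} → p ⊆ q → ∣ q ∣ ≤ ∣ p ∣ → q ⊆ p
p⊆q⇒∣q∣≤∣p∣⇒q⊆p {p = []}          {[]}          _   _ = id
p⊆q⇒∣q∣≤∣p∣⇒q⊆p {p = outside ∷ p} {outside ∷ q} p⊆q ∣q∣≤∣p∣ =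
  s⊆s (p⊆q⇒∣q∣≤∣p∣⇒q⊆p (drop-∷-⊆ p⊆q) ∣q∣≤∣p∣)
p⊆q⇒∣q∣≤∣p∣⇒q⊆p {p = outside ∷ p} {inside ∷ q}  p⊆q ∣q∣≤∣p∣ =
  contradiction (≤-trans ∣q∣≤∣p∣ (p⊆q⇒∣p∣≤∣q∣ (drop-∷-⊆ p⊆q))) (<-irrefl refl)
p⊆q⇒∣q∣≤∣p∣⇒q⊆p {p = inside ∷ p}  {outside ∷ q} p⊆q _ with p⊆q here
... | ()
p⊆q⇒∣q∣≤∣p∣⇒q⊆p {p = inside ∷ p}  {inside ∷ q}  p⊆q ∣q∣≤∣p∣ =
  s⊆s (p⊆q⇒∣q∣≤∣p∣⇒q⊆p (drop-∷-⊆ p⊆q) (≤-pred ∣q∣≤∣p∣))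

-- IsStrongShellingOrder Δ L unfolds to IsFacetOrder Δ L × EarlierWitnessed StrongShellingStep L.
EarlierWitnessed : ∀ {a r} {A : Set a} → (A → A → A → Set r) → List A → Set r
EarlierWitnessed R L =
  ∀ (i j : Fin (length L)) → toℕ i < toℕ j →
    ∃[ k ] (toℕ k < toℕ j × R (lookup L i) (lookup L j) (lookup L k))

StrongShellingStep : Subset n → Subset n → Subset n → Set
StrongShellingStep Fᵢ Fⱼ Fₖ = ∣ Fⱼ ─ Fₖ ∣ ≡ 1 × (Fⱼ ─ Fₖ) ⊆ (Fⱼ ─ Fᵢ) × (Fₖ ─ Fⱼ) ⊆ Fᵢ

module _ {a p} {A : Set a} {P : Pred A p} (P? : Decidable P) where

  filter-index : (xs : List A) → Fin (length (filter P? xs)) → Fin (length xs)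
  filter-index (x ∷ xs) i with P? x
  filter-index (x ∷ xs) fzero    | yes _ = fzero
  filter-index (x ∷ xs) (fsuc i) | yes _ = fsuc (filter-index xs i)
  filter-index (x ∷ xs) i        | no  _ = fsuc (filter-index xs i)

  lookup-filter : (xs : List A) (i : Fin (length (filter P? xs))) →
                    lookup (filter P? xs) i ≡ lookup xs (filter-index xs i)
  lookup-filter (x ∷ xs) i with P? x
  lookup-filter (x ∷ xs) fzero    | yes _ = refl
  lookup-filter (x ∷ xs) (fsuc i) | yes _ = lookup-filter xs i
  lookup-filter (x ∷ xs) i        | no  _ = lookup-filter xs i

  filter-index-mono-< : (xs : List A) (i j : Fin (length (filter P? xs))) →
                    toℕ i < toℕ j → toℕ (filter-index xs i) < toℕ (filter-index xs j)
  filter-index-mono-< (x ∷ xs) i j i<j with P? x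
  filter-index-mono-< (x ∷ xs) fzero    (fsuc j) _         | yes _ = s≤s z≤n
  filter-index-mono-< (x ∷ xs) (fsuc i) (fsuc j) (s≤s i<j) | yes _ = s≤s (filter-index-mono-< xs i j i<j)
  filter-index-mono-< (x ∷ xs) i        j        i<j       | no  _ = s≤s (filter-index-mono-< xs i j i<j)

  filter-index-cancel-< : (xs : List A) (i j : Fin (length (filter P? xs))) →
                      toℕ (filter-index xs i) < toℕ (filter-index xs j) → toℕ i < toℕ j
  filter-index-cancel-< (x ∷ xs) i j i<j with P? x
  filter-index-cancel-< (x ∷ xs) fzero    (fsuc j) _         | yes _ = s≤s z≤n
  filter-index-cancel-< (x ∷ xs) (fsuc i) (fsuc j) (s≤s i<j) | yes _ = s≤s (filter-index-cancel-< xs i j i<j)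
  filter-index-cancel-< (x ∷ xs) i        j        (s≤s i<j) | no  _ = filter-index-cancel-< xs i j i<j

  filter-index-surjective : (xs : List A) (k : Fin (length xs)) → P (lookup xs k) →
                        ∃[ i ] filter-index xs i ≡ k
  filter-index-surjective (x ∷ xs) k Pk with P? x
  filter-index-surjective (x ∷ xs) fzero    _  | yes _ = fzero , refl
  filter-index-surjective (x ∷ xs) (fsuc k) Pk | yes _ with filter-index-surjective xs k Pk
  ... | i , refl = fsuc i , refl
  filter-index-surjective (x ∷ xs) fzero    Px | no ¬Px = contradiction Px ¬Px
  filter-index-surjective (x ∷ xs) (fsuc k) Pk | no _ with filter-index-surjective xs k Pk
  ... | i , refl = i , refl

  filter-earlierWitnessed : ∀ {r} {R : A → A → A → Set r} {L : List A} →
                            (∀ {x y z} → y ∈ L → z ∈ L → R x y z → P y → P z) →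
                            EarlierWitnessed R L → EarlierWitnessed R (filter P? L)
  filter-earlierWitnessed {R = R} {L} P-closed witnessed i j i<j
    with witnessed (filter-index L i) (filter-index L j) (filter-index-mono-< L i j i<j)
  ... | k , k<j , Rijk
    with filter-index-surjective L k (P-closed (∈-lookup (filter-index L j)) (∈-lookup k) Rijk Pj)
    where Pj = subst P (lookup-filter L j) (proj₂ (∈-filter⁻ P? {xs = L} (∈-lookup j)))
  ... | k′ , refl =
    k′ , filter-index-cancel-< L k′ j k<j ,
    subst (R _ _) (sym (lookup-filter L k′))
      (subst₂ (λ x y → R x y _) (sym (lookup-filter L i)) (sym (lookup-filter L j)) Rijk)

filter-isFacetOrder : {Δ Δ′ : Family n} {P : Subset n → Set} (P? : Decidable P) {L : List (Subset n)} →
                      (∀ F → IsFacet Δ′ F ⇔ (IsFacet Δ F × P F)) →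
                      IsFacetOrder Δ L → IsFacetOrder Δ′ (filter P? L)
filter-isFacetOrder P? facets⇔ (unique , facetsOfL) = filter⁺ P? unique , λ F →
  (λ F∈filter → let F∈L , PF = ∈-filter⁻ P? F∈filter in
                Equivalence.from (facets⇔ F) (proj₁ (facetsOfL F) F∈L , PF)) ,
  (λ facet′ → let facet , PF = Equivalence.to (facets⇔ F) facet′ in
              ∈-filter⁺ P? (proj₂ (facetsOfL F) facet) PF)

module _ {Δ : Family n} where

  ∣F∣≡max⇒IsFacet : ∀ {m F} → (∀ A → Δ A → ∣ A ∣ ≤ m) → Δ F → ∣ F ∣ ≡ m → IsFacet Δ F
  ∣F∣≡max⇒IsFacet bounded ΔF ∣F∣≡m = ΔF , λ G ΔG F⊆G →
    ⊆-antisym (p⊆q⇒∣q∣≤∣p∣⇒q⊆p F⊆G (subst (∣ G ∣ ≤_) (sym ∣F∣≡m) (bounded G ΔG))) F⊆G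

  IsFacet-pureSkeleton⇔ : ∀ {d F} → IsFacet (PureSkeleton Δ d) F ⇔ (Δ F × ∣ F ∣ ≡ suc d)
  IsFacet-pureSkeleton⇔ {d} {F} = mk⇔ to from
    where
    to : IsFacet (PureSkeleton Δ d) F → Δ F × ∣ F ∣ ≡ suc d
    to ((H , ΔH , ∣H∣≡1+d , F⊆H) , maximal) with maximal H (H , ΔH , ∣H∣≡1+d , id) F⊆H
    ... | refl = ΔH , ∣H∣≡1+d

    from : Δ F × ∣ F ∣ ≡ suc d → IsFacet (PureSkeleton Δ d) F
    from (ΔF , ∣F∣≡1+d) = (F , ΔF , ∣F∣≡1+d , id) , λ G (H , _ , ∣H∣≡1+d , G⊆H) F⊆G →
      let H⊆F = p⊆q⇒∣q∣≤∣p∣⇒q⊆p (⊆-trans F⊆G G⊆H) (≤-reflexive (trans ∣H∣≡1+d (sym ∣F∣≡1+d)))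
      in ⊆-antisym (⊆-trans G⊆H H⊆F) F⊆G

  -- Otherwise ∣ F ∣ ≤ ∣ G ∩ F ∣ = ∣ G ∣ - 1, which forces F ⊆ G.
  IsFacet∧∣G─F∣≡1⇒∣G∣≤∣F∣ : ∀ {F G} → IsFacet Δ F → Δ G → ∣ G ─ F ∣ ≡ 1 → ∣ G ∣ ≤ ∣ F ∣
  IsFacet∧∣G─F∣≡1⇒∣G∣≤∣F∣ {F} {G} (_ , maximal) ΔG ∣G─F∣≡1 = ≮⇒≥ λ ∣F∣<∣G∣ →
    <-irrefl (cong ∣_∣ (sym (maximal G ΔG (F⊆G ∣F∣<∣G∣)))) ∣F∣<∣G∣
    where
    ∣G∣≡1+∣G∩F∣ : ∣ G ∣ ≡ suc ∣ G ∩ F ∣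
    ∣G∣≡1+∣G∩F∣ = trans (∣p∣≡∣p─q∣+∣p∩q∣ G F) (cong (_+ ∣ G ∩ F ∣) ∣G─F∣≡1)

    F⊆G : ∣ F ∣ < ∣ G ∣ → F ⊆ G
    F⊆G ∣F∣<∣G∣ = ⊆-trans (p⊆q⇒∣q∣≤∣p∣⇒q⊆p (p∩q⊆q G F) ∣F∣≤∣G∩F∣) (p∩q⊆p G F)
      where ∣F∣≤∣G∩F∣ = ≤-pred (subst (suc ∣ F ∣ ≤_) ∣G∣≡1+∣G∩F∣ ∣F∣<∣G∣)

proposition2p10 : (n d : ℕ) (Δ : Family n) → IsSimplicialComplex Δ → HasDimension Δ d → StronglyShellable Δ → StronglyShellable (PureSkeleton Δ d)
proposition2p10 n d Δ _ (_ , bounded) (L , order , shelling) =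
  filter P? L ,
  filter-isFacetOrder P? facets⇔ order ,
  filter-earlierWitnessed P? {R = StrongShellingStep} topDimensional shelling
  where
  P : Subset n → Set
  P F = ∣ F ∣ ≡ suc d

  P? : Decidable P
  P? F = ∣ F ∣ ≟ suc d

  facets⇔ : ∀ F → IsFacet (PureSkeleton Δ d) F ⇔ (IsFacet Δ F × P F)
  facets⇔ F = mk⇔
    (λ facet′ → let ΔF , PF = Equivalence.to IsFacet-pureSkeleton⇔ facet′ in
                ∣F∣≡max⇒IsFacet bounded ΔF PF , PF)
    (λ (facet , PF) → Equivalence.from IsFacet-pureSkeleton⇔ (proj₁ facet , PF))

  facetOfL : ∀ {F} → F ∈ L → IsFacet Δ F
  facetOfL {F} = proj₁ (proj₂ order F)

  topDimensional : ∀ {Fᵢ Fⱼ Fₖ} → Fⱼ ∈ L → Fₖ ∈ L → StrongShellingStep Fᵢ Fⱼ Fₖ → P Fⱼ → P Fₖ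
  topDimensional {Fₖ = Fₖ} Fⱼ∈L Fₖ∈L (∣Fⱼ─Fₖ∣≡1 , _) ∣Fⱼ∣≡1+d =
    ≤-antisym (bounded Fₖ (proj₁ (facetOfL Fₖ∈L)))
      (subst (_≤ ∣ Fₖ ∣) ∣Fⱼ∣≡1+d
        (IsFacet∧∣G─F∣≡1⇒∣G∣≤∣F∣ (facetOfL Fₖ∈L) (proj₁ (facetOfL Fⱼ∈L)) ∣Fⱼ─Fₖ∣≡1))
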